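{- Let $k\geq 2$ and $n$ be positive integers, and let $a_1<a_2<\cdots<a_k$ be positive integers satisfying $$\frac{n}{2^{n}}=\sum_{i=1}^{k}\frac{a_{i}}{2^{a_{i}}}.$$ Then: (i) $n\leq 2^{k+1}-k-2$; (ii) $n+1\leq a_1\leq n+3$ and $2^{a_k-a_{k-1}}$ divides $a_k$. Moreover, if $n\geq 2^{j+1}-j$ for some integer $j$ with $1\leq j<k$, then $a_i=n+i$ for all $i=1,\ldots,j$.
   Context: The equation $\frac{n}{2^{n}}=\sum_{i=1}^{k}\frac{a_{i}}{2^{a_{i}}}$ (the Erdős–Graham equation) is considered in positive integers $n,k,a_1,\ldots,a_k$ with $k\geq 2$ and $a_1<a_2<\cdots<a_k$. -}

module Defs where

open import Data.Nat using (ℕ; zero; suc; _^_)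
open import Data.Nat.Properties using (m^n≢0)
open import Data.Fin using (Fin; zero; suc)
open import Data.Integer using (+_)
open import Data.Rational using (ℚ; _/_; _+_; 0ℚ)

term : ℕ → ℚ
term m = (+ m) / (2 ^ m)
  where instance _ = m^n≢0 2 m

Σᶠ : (k : ℕ) → (Fin k → ℚ) → ℚ
Σᶠ zero    f = 0ℚ
Σᶠ (suc k) f = f zero + Σᶠ k (λ i → f (suc i))

open import Data.Nat using (_≤_; _<_; _∸_; s≤s; z≤n)
open import Data.Fin using (fromℕ; inject₁)

first : ∀ {k} → 2 ≤ k → Fin k
first (s≤s _) = zero

last : ∀ {k} → 2 ≤ k → Fin k
last {suc (suc m)} (s≤s (s≤s _)) = fromℕ (suc m)

penult : ∀ {k} → 2 ≤ k → Fin k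
penult {suc (suc m)} (s≤s (s≤s _)) = inject₁ (fromℕ m)

module Submission where

-- Multiplying through by 2^M for a large M turns the equation into the identity of naturals
-- n·2^(M−n) = Σ aᵢ·2^(M−aᵢ).  The basic estimate is Σ_{m=c}^{M} m/2^m = (c+1)/2^(c−1) − (M+2)/2^M,
-- so the sum of distinct terms m/2^m with m ≥ c is strictly below (c+1)/2^(c−1).  Peeling off the
-- leading terms aᵢ = n+i one at a time, the remaining terms always sum to (n+t+2−2^(t+1))/2^(n+t).
-- If every term is peeled, n+k+2 = 2^(k+1).  Otherwise the first term skipping a value is at least
-- n+t+2, and the estimate gives n+t+2 ≤ 2^(t+2); this yields the bound on n and shows that no
-- j > t can satisfy n ≥ 2^(j+1) − j.  The divisibility comes from reading the cleared equation
-- with M = a_k modulo 2^(a_k − a_{k−1}), which divides every term except the last.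

open import Defs
open import Data.Nat using (ℕ; zero; suc; _+_; _*_; _∸_; _^_; _≤_; _<_; z≤n; s≤s; NonZero)
open import Data.Nat.Properties
open import Data.Nat.Divisibility using (_∣_; ∣-trans; n∣m*n; m∣m*n; ∣m∣n⇒∣m+n; ∣m+n∣m⇒∣n; _∣0)
open import Data.Nat.Tactic.RingSolver using (solve-∀)
open import Data.Fin using (Fin; zero; suc; toℕ; fromℕ; inject₁)
open import Data.Fin.Properties using (toℕ-inject₁; toℕ-fromℕ; toℕ≤pred[n]; toℕ-injective)
open import Data.Product using (_×_; _,_)
open import Data.Sum using (inj₁; inj₂)
open import Data.Empty using (⊥; ⊥-elim)
import Data.Integer as ℤ
import Data.Integer.Properties as ℤP
import Data.Integer.Tactic.RingSolver as ℤSolver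
open import Data.Rational as ℚ using (ℚ; toℚᵘ)
import Data.Rational.Properties as ℚP
open import Data.Rational.Unnormalised as ℚᵘ using (ℚᵘ; *≡*; _≃_)
import Data.Rational.Unnormalised.Properties as ℚᵘP
open import Algebra.Properties.Monoid.Sum +-0-monoid using (sum; sum-init-last)
open import Function using (_∘_)
open import Relation.Binary.PropositionalEquality

m+c*n≤m*2^n : ∀ {c} m n → c ≤ m → m + c * n ≤ m * 2 ^ n
m+c*n≤m*2^n {c} m zero _ = ≤-reflexive (trivial m c)
  where
  trivial : ∀ m c → m + c * 0 ≡ m * 1
  trivial = solve-∀
m+c*n≤m*2^n {c} m (suc n) c≤m = begin
  m + c * suc n           ≡⟨ regroup m c n ⟩
  c + (m + c * n)         ≤⟨ +-mono-≤ (≤-trans c≤m (m≤m*n m (2 ^ n))) (m+c*n≤m*2^n m n c≤m) ⟩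
  m * 2 ^ n + m * 2 ^ n   ≡⟨ double m (2 ^ n) ⟩
  m * 2 ^ suc n           ∎
  where
  open ≤-Reasoning
  instance _ = m^n≢0 2 n
  regroup : ∀ m c n → m + c * suc n ≡ c + (m + c * n)
  regroup = solve-∀
  double : ∀ m x → m * x + m * x ≡ m * (2 * x)
  double = solve-∀

m+n≤m*2^n : ∀ m n → 1 ≤ m → m + n ≤ m * 2 ^ n
m+n≤m*2^n m n 1≤m = subst (_≤ m * 2 ^ n) (cong (m +_) (*-identityˡ n)) (m+c*n≤m*2^n m n 1≤m)

-- y / 2^y ≤ x / 2^x for 1 ≤ x ≤ y, multiplied through by 2^(x + d).
m/2^m-antitone : ∀ {x y d d′} → 1 ≤ x → x ≤ y → x + d ≡ y + d′ → y * 2 ^ d′ ≤ x * 2 ^ d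
m/2^m-antitone {x} {y} {d} {d′} 1≤x x≤y x+d≡y+d′ with m≤n⇒∃[o]m+o≡n x≤y
... | r , refl = begin
  (x + r) * 2 ^ d′     ≤⟨ *-monoˡ-≤ (2 ^ d′) (m+n≤m*2^n x r 1≤x) ⟩
  x * 2 ^ r * 2 ^ d′   ≡⟨ *-assoc x _ _ ⟩
  x * (2 ^ r * 2 ^ d′) ≡⟨ cong (x *_) (^-distribˡ-+-* 2 r d′) ⟨
  x * 2 ^ (r + d′)     ≡⟨ cong (λ z → x * 2 ^ z) d≡r+d′ ⟨
  x * 2 ^ d            ∎
  where
  open ≤-Reasoning
  d≡r+d′ : d ≡ r + d′
  d≡r+d′ = +-cancelˡ-≡ x d (r + d′) (trans x+d≡y+d′ (+-assoc x r d′))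

^-monoʳ-∣ : ∀ m {n o} → n ≤ o → m ^ n ∣ m ^ o
^-monoʳ-∣ m {n} n≤o with m≤n⇒∃[o]m+o≡n n≤o
... | r , refl = subst (m ^ n ∣_) (sym (^-distribˡ-+-* m n r)) (m∣m*n (m ^ r))

-- m / 2^m multiplied by 2^M; the truncated subtraction makes this meaningless unless m ≤ M.
scaled : ℕ → ℕ → ℕ
scaled M m = m * 2 ^ (M ∸ m)

scaled-depth : ∀ {M m e} → m + e ≡ M → scaled M m ≡ m * 2 ^ e
scaled-depth {m = m} {e} refl = cong (λ z → m * 2 ^ z) (m+n∸m≡n m e)

scaled-self : ∀ M → scaled M M ≡ M
scaled-self M = trans (cong (λ z → M * 2 ^ z) (n∸n≡0 M)) (*-identityʳ M)

scaled-antitone : ∀ {M x y} → 1 ≤ x → x ≤ y → y ≤ M → scaled M y ≤ scaled M x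
scaled-antitone 1≤x x≤y y≤M = m/2^m-antitone 1≤x x≤y
  (trans (m+[n∸m]≡n (≤-trans x≤y y≤M)) (sym (m+[n∸m]≡n y≤M)))

scaled-divisible : ∀ {M x y} → x ≤ y → 2 ^ (M ∸ y) ∣ scaled M x
scaled-divisible {M} {x} x≤y = ∣-trans (^-monoʳ-∣ 2 (∸-monoʳ-≤ M x≤y)) (n∣m*n x)

_/2^_ : ℕ → ℕ → ℚᵘ
X /2^ M = ℤ.+ X ℚᵘ./ 2 ^ M
  where instance _ = m^n≢0 2 M

toℚᵘ-/ : ∀ p d .{{_ : NonZero d}} → toℚᵘ (p ℚ./ d) ≃ p ℚᵘ./ d
toℚᵘ-/ p (suc d) = ℚP.toℚᵘ-fromℚᵘ (p ℚᵘ./ suc d)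

/-+ : ∀ X Y d .{{_ : NonZero d}} → ℤ.+ X ℚᵘ./ d ℚᵘ.+ ℤ.+ Y ℚᵘ./ d ≃ ℤ.+ (X + Y) ℚᵘ./ d
/-+ X Y (suc d) = *≡* (trans (distrib (ℤ.+ X) (ℤ.+ Y) (ℤ.+ suc d))
  (cong₂ ℤ._*_ (sym (ℤP.pos-+ X Y)) (sym (ℤP.pos-* (suc d) (suc d)))))
  where
  distrib : ∀ x y z → (x ℤ.* z ℤ.+ y ℤ.* z) ℤ.* z ≡ (x ℤ.+ y) ℤ.* (z ℤ.* z)
  distrib = ℤSolver.solve-∀

/-injective : ∀ X Y d .{{_ : NonZero d}} → ℤ.+ X ℚᵘ./ d ≃ ℤ.+ Y ℚᵘ./ d → X ≡ Y
/-injective X Y (suc d) (*≡* eq) = ℤP.+-injective (ℤP.*-cancelʳ-≡ (ℤ.+ X) (ℤ.+ Y) (ℤ.+ suc d) eq)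

term≃scaled : ∀ {M m} → m ≤ M → toℚᵘ (term m) ≃ scaled M m /2^ M
term≃scaled {M} {m} m≤M = begin
  toℚᵘ (term m)                      ≈⟨ toℚᵘ-/ (ℤ.+ m) (2 ^ m) ⟩
  ℤ.+ m ℚᵘ./ 2 ^ m                   ≈⟨ ℚᵘP.*-cancelʳ-/ c {ℤ.+ m} {2 ^ m} ⟨
  (ℤ.+ m ℤ.* ℤ.+ c) ℚᵘ./ (2 ^ m * c) ≡⟨ ℚᵘP./-cong (sym (ℤP.pos-* m c)) 2^m*c≡2^M ⟩
  scaled M m /2^ M                   ∎
  where
  open ℚᵘP.≃-Reasoning
  c : ℕ
  c = 2 ^ (M ∸ m)
  instance
    _ = m^n≢0 2 m
    _ = m^n≢0 2 M
    _ = m^n≢0 2 (M ∸ m)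
    _ = m*n≢0 (2 ^ m) c
  2^m*c≡2^M : 2 ^ m * c ≡ 2 ^ M
  2^m*c≡2^M = trans (sym (^-distribˡ-+-* 2 m (M ∸ m))) (cong (2 ^_) (m+[n∸m]≡n m≤M))

toℚᵘ-Σᶠ : ∀ {k} (f : Fin k → ℚ) (g : Fin k → ℕ) d .{{_ : NonZero d}} →
          (∀ i → toℚᵘ (f i) ≃ ℤ.+ g i ℚᵘ./ d) → toℚᵘ (Σᶠ k f) ≃ ℤ.+ sum g ℚᵘ./ d
toℚᵘ-Σᶠ {zero}  f g (suc d) _   = *≡* refl
toℚᵘ-Σᶠ {suc k} f g d       f≃g = begin
  toℚᵘ (f zero ℚ.+ Σᶠ k (f ∘ suc))                ≈⟨ ℚP.toℚᵘ-homo-+ (f zero) _ ⟩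
  toℚᵘ (f zero) ℚᵘ.+ toℚᵘ (Σᶠ k (f ∘ suc))        ≈⟨ ℚᵘP.+-cong (f≃g zero) tail≃ ⟩
  ℤ.+ g zero ℚᵘ./ d ℚᵘ.+ ℤ.+ sum (g ∘ suc) ℚᵘ./ d ≈⟨ /-+ (g zero) (sum (g ∘ suc)) d ⟩
  ℤ.+ sum g ℚᵘ./ d                                ∎
  where
  open ℚᵘP.≃-Reasoning
  tail≃ : toℚᵘ (Σᶠ k (f ∘ suc)) ≃ ℤ.+ sum (g ∘ suc) ℚᵘ./ d
  tail≃ = toℚᵘ-Σᶠ (f ∘ suc) (g ∘ suc) d (f≃g ∘ suc)

cleared-equation : ∀ {k M n} (a : Fin k → ℕ) → n ≤ M → (∀ i → a i ≤ M) →
                   term n ≡ Σᶠ k (term ∘ a) → scaled M n ≡ sum (scaled M ∘ a)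
cleared-equation {k} {M} {n} a n≤M a≤M eq = /-injective _ _ (2 ^ M) (begin
  scaled M n /2^ M             ≈⟨ term≃scaled n≤M ⟨
  toℚᵘ (term n)                ≡⟨ cong toℚᵘ eq ⟩
  toℚᵘ (Σᶠ k (term ∘ a))       ≈⟨ toℚᵘ-Σᶠ _ (scaled M ∘ a) (2 ^ M) (term≃scaled ∘ a≤M) ⟩
  sum (scaled M ∘ a) /2^ M     ∎)
  where
  open ℚᵘP.≃-Reasoning
  instance _ = m^n≢0 2 M

∣-sum : ∀ {d k} (f : Fin k → ℕ) → (∀ i → d ∣ f i) → d ∣ sum f
∣-sum {d} {zero}  f _   = d ∣0
∣-sum {d} {suc k} f d∣f = ∣m∣n⇒∣m+n (d∣f zero) (∣-sum (f ∘ suc) (d∣f ∘ suc))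

Increasing : ∀ {k} → (Fin k → ℕ) → Set
Increasing a = ∀ i j → toℕ i < toℕ j → a i < a j

Increasing-tail : ∀ {k} {a : Fin (suc k) → ℕ} → Increasing a → Increasing (a ∘ suc)
Increasing-tail inc i j i<j = inc (suc i) (suc j) (s≤s i<j)

Increasing-init : ∀ {k} {a : Fin (suc k) → ℕ} → Increasing a → Increasing (a ∘ inject₁)
Increasing-init inc i j i<j =
  inc (inject₁ i) (inject₁ j) (subst₂ _<_ (sym (toℕ-inject₁ i)) (sym (toℕ-inject₁ j)) i<j)

head-least : ∀ {k} {a : Fin (suc k) → ℕ} → Increasing a → ∀ i → a zero ≤ a i
head-least inc zero    = ≤-refl
head-least inc (suc i) = <⇒≤ (inc zero (suc i) (s≤s z≤n))

last-greatest : ∀ {k} {a : Fin (suc k) → ℕ} → Increasing a → ∀ i → a i ≤ a (fromℕ k)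
last-greatest {k} {a} inc i
  with m≤n⇒m<n∨m≡n (subst (toℕ i ≤_) (sym (toℕ-fromℕ k)) (toℕ≤pred[n] i))
... | inj₁ i<last = <⇒≤ (inc i (fromℕ k) i<last)
... | inj₂ i≡last = ≤-reflexive (cong a (toℕ-injective i≡last))

tail-sum-bound : ∀ {k M c d} (b : Fin k → ℕ) → Increasing b → (∀ i → c ≤ b i) →
                 (∀ i → b i ≤ M) → c + d ≡ suc M → sum (scaled M ∘ b) + (2 + M) ≤ (1 + c) * 2 ^ d
tail-sum-bound {zero} {M} {c} {d} _ _ _ _ c+d≡1+M = begin
  2 + M           ≡⟨ *-identityʳ (2 + M) ⟨
  (2 + M) * 2 ^ 0 ≤⟨ m/2^m-antitone (s≤s z≤n) (s≤s c≤1+M) (cong suc c+d≡1+M+0) ⟩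
  (1 + c) * 2 ^ d ∎
  where
  open ≤-Reasoning
  c≤1+M : c ≤ suc M
  c≤1+M = subst (c ≤_) c+d≡1+M (m≤m+n c d)
  c+d≡1+M+0 : c + d ≡ suc M + 0
  c+d≡1+M+0 = trans c+d≡1+M (sym (+-identityʳ (suc M)))
tail-sum-bound {suc k} {M} {c} {d} b inc c≤b b≤M c+d≡1+M = begin
  scaled M v + sum (scaled M ∘ b ∘ suc) + (2 + M)   ≡⟨ +-assoc (scaled M v) _ _ ⟩
  v * 2 ^ e + (sum (scaled M ∘ b ∘ suc) + (2 + M))  ≤⟨ +-monoʳ-≤ (v * 2 ^ e) rest ⟩
  v * 2 ^ e + (2 + v) * 2 ^ e                       ≡⟨ merge v (2 ^ e) ⟩
  (1 + v) * 2 ^ suc e                               ≤⟨ m/2^m-antitone (s≤s z≤n) (s≤s (c≤b zero)) depth-match ⟩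
  (1 + c) * 2 ^ d                                   ∎
  where
  open ≤-Reasoning
  v e : ℕ
  v = b zero
  e = M ∸ v
  v+e≡M : v + e ≡ M
  v+e≡M = m+[n∸m]≡n (b≤M zero)
  depth-match : 1 + c + d ≡ 1 + v + suc e
  depth-match = cong suc (trans c+d≡1+M (sym (trans (+-suc v e) (cong suc v+e≡M))))
  rest : sum (scaled M ∘ b ∘ suc) + (2 + M) ≤ (2 + v) * 2 ^ e
  rest = tail-sum-bound (b ∘ suc) (Increasing-tail inc) (λ i → inc zero (suc i) (s≤s z≤n))
           (b≤M ∘ suc) (cong suc v+e≡M)
  merge : ∀ v u → v * u + (2 + v) * u ≡ (1 + v) * (2 * u)
  merge = solve-∀

tail-sum-< : ∀ {k M c d} (b : Fin k → ℕ) → Increasing b → (∀ i → c ≤ b i) → (∀ i → b i ≤ M) →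
             c + d ≡ suc M → sum (scaled M ∘ b) < (1 + c) * 2 ^ d
tail-sum-< b inc c≤b b≤M c+d≡1+M =
  <-≤-trans (m<m+n _ (s≤s z≤n)) (tail-sum-bound b inc c≤b b≤M c+d≡1+M)

first-term-above : ∀ {k M n} (a : Fin (suc (suc k)) → ℕ) → (∀ i → 1 ≤ a i) → n ≤ M →
                   (∀ i → a i ≤ M) → scaled M n ≡ sum (scaled M ∘ a) → n < a zero
first-term-above {M = M} {n} a 1≤a n≤M a≤M eq = ≰⇒> λ a₀≤n → <-irrefl eq (begin-strict
  scaled M n           ≤⟨ scaled-antitone (1≤a zero) a₀≤n n≤M ⟩
  scaled M (a zero)    <⟨ m<m+n _ (≤-trans second-positive (m≤m+n _ _)) ⟩
  sum (scaled M ∘ a)   ∎)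
  where
  open ≤-Reasoning
  second-positive : 1 ≤ scaled M (a (suc zero))
  second-positive = *-mono-≤ (1≤a (suc zero)) (m^n>0 2 (M ∸ a (suc zero)))

first-term-below : ∀ {k M n} (a : Fin (suc k) → ℕ) → 1 ≤ n → Increasing a → (∀ i → a i ≤ M) →
                   scaled M n ≡ sum (scaled M ∘ a) → a zero ≤ 3 + n
first-term-below {M = M} {n} a 1≤n inc a≤M eq = ≮⇒≥ excess-impossible
  where
  excess-impossible : 3 + n < a zero → ⊥
  excess-impossible 3+n<a₀ with m≤n⇒∃[o]m+o≡n (≤-trans (<⇒≤ 3+n<a₀) (a≤M zero))
  ... | d , 3+n+d≡M = <⇒≱ (*-cancelʳ-< (2 ^ d) (8 * n) (5 + n) (begin-strict
    8 * n * 2 ^ d        ≡⟨ eight n (2 ^ d) ⟩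
    n * 2 ^ (3 + d)      ≡⟨ scaled-depth {m = n} (trans (shift n d) 3+n+d≡M) ⟨
    scaled M n           ≡⟨ eq ⟩
    sum (scaled M ∘ a)   <⟨ tail-sum-< a inc (≤-trans 3+n<a₀ ∘ head-least inc) a≤M (cong suc 3+n+d≡M) ⟩
    (5 + n) * 2 ^ d      ∎)) (5+n≤8n 1≤n)
    where
    open ≤-Reasoning
    eight : ∀ n u → 8 * n * u ≡ n * (2 * (2 * (2 * u)))
    eight = solve-∀
    shift : ∀ n d → n + (3 + d) ≡ 3 + n + d
    shift = solve-∀
    5+n≤8n : ∀ {n} → 1 ≤ n → 5 + n ≤ 8 * n
    5+n≤8n {suc n} _ = subst (5 + suc n ≤_) (sym (split n)) (m≤m+n _ _)
      where
      split : ∀ n → 8 * suc n ≡ 5 + suc n + (2 + 7 * n)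
      split = solve-∀

last-gap-divides : ∀ {k n} (a : Fin (suc (suc k)) → ℕ) → Increasing a →
                   n ≤ a (inject₁ (fromℕ k)) →
                   scaled (a (fromℕ (suc k))) n ≡ sum (scaled (a (fromℕ (suc k))) ∘ a) →
                   2 ^ (a (fromℕ (suc k)) ∸ a (inject₁ (fromℕ k))) ∣ a (fromℕ (suc k))
last-gap-divides {k} {n} a inc n≤p eq =
  subst (D ∣_) (scaled-self M) (∣m+n∣m⇒∣n divides-total (∣-sum _ divides-init))
  where
  M D : ℕ
  M = a (fromℕ (suc k))
  D = 2 ^ (M ∸ a (inject₁ (fromℕ k)))
  divides-init : ∀ i → D ∣ scaled M (a (inject₁ i))
  divides-init i = scaled-divisible (last-greatest (Increasing-init inc) i)
  divides-total : D ∣ sum (scaled M ∘ a ∘ inject₁) + scaled M M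
  divides-total = subst (D ∣_) (trans eq (sum-init-last (scaled M ∘ a))) (scaled-divisible n≤p)

-- With M = t + n + e, the remaining terms b satisfy Σ b_i / 2^b_i = (n + t + 2 − 2^(t+1)) / 2^(n+t).
record Remainder (n M t e : ℕ) {k : ℕ} (b : Fin k → ℕ) : Set where
  constructor remainder
  field equation : sum (scaled M ∘ b) + 2 ^ suc t * 2 ^ e ≡ (2 + (t + n)) * 2 ^ e

SizeBound : ℕ → ℕ → Set
SizeBound n s = 2 + (s + n) ≤ 2 ^ suc s

remainder-start : ∀ {k M n} (a : Fin k → ℕ) → scaled M n ≡ sum (scaled M ∘ a) →
                  Remainder n M 0 (M ∸ n) a
remainder-start {M = M} {n} a eq = remainder (begin
  sum (scaled M ∘ a) + 2 ^ 1 * 2 ^ (M ∸ n)  ≡⟨ cong (_+ 2 ^ 1 * 2 ^ (M ∸ n)) eq ⟨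
  n * 2 ^ (M ∸ n) + 2 ^ 1 * 2 ^ (M ∸ n)     ≡⟨ collect n (2 ^ (M ∸ n)) ⟩
  (2 + n) * 2 ^ (M ∸ n)                      ∎)
  where
  open ≡-Reasoning
  collect : ∀ n u → n * u + 2 ^ 1 * u ≡ (2 + n) * u
  collect = solve-∀

remainder-exhausted : ∀ {n M t e} {b : Fin 0 → ℕ} → Remainder n M t e b → 2 + (t + n) ≡ 2 ^ suc t
remainder-exhausted {e = e} (remainder rem) = sym (*-cancelʳ-≡ _ _ (2 ^ e) {{m^n≢0 2 e}} rem)

remainder-step : ∀ {n M t e k} (b : Fin (suc k) → ℕ) → t + n + suc e ≡ M → b zero ≡ suc (t + n) →
                 Remainder n M t (suc e) b → Remainder n M (suc t) e (b ∘ suc)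
remainder-step {n} {M} {t} {e} b M≡ b₀≡ (remainder rem) = remainder (+-cancelˡ-≡ W _ _ (begin
  W + (S + 2 * P * u)            ≡⟨ regroup W S P u ⟩
  W + S + P * (2 * u)            ≡⟨ rem ⟩
  (2 + p) * (2 * u)              ≡⟨ split p u ⟩
  suc p * u + (3 + p) * u        ≡⟨ cong (_+ (3 + p) * u) W≡ ⟨
  W + (3 + p) * u                ∎))
  where
  open ≡-Reasoning
  p u P W S : ℕ
  p = t + n
  u = 2 ^ e
  P = 2 ^ suc t
  W = scaled M (b zero)
  S = sum (scaled M ∘ b ∘ suc)
  W≡ : W ≡ suc p * u
  W≡ = trans (cong (scaled M) b₀≡) (scaled-depth (trans (sym (+-suc p e)) M≡))
  regroup : ∀ W S P u → W + (S + 2 * P * u) ≡ W + S + P * (2 * u)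
  regroup = solve-∀
  split : ∀ p u → (2 + p) * (2 * u) ≡ suc p * u + (3 + p) * u
  split = solve-∀

gap-bound : ∀ {n M t e k} (b : Fin (suc k) → ℕ) → Increasing b → (∀ i → b i ≤ M) →
            t + n + suc e ≡ M → 2 + (t + n) ≤ b zero → Remainder n M t (suc e) b →
            2 + (t + n) ≤ 2 ^ suc (suc t)
gap-bound {n} {M} {t} {e} b inc b≤M M≡ gap (remainder rem) =
  *-cancelʳ-< u (suc p) (2 * P) (+-cancelˡ-< ((3 + p) * u) _ _ (begin-strict
    (3 + p) * u + suc p * u            ≡⟨ split p u ⟩
    (2 + p) * (2 * u)                  ≡⟨ rem ⟨
    sum (scaled M ∘ b) + P * (2 * u)   <⟨ +-monoˡ-< (P * (2 * u)) below ⟩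
    (3 + p) * u + P * (2 * u)          ≡⟨ cong ((3 + p) * u +_) (regroup P u) ⟩
    (3 + p) * u + 2 * P * u            ∎))
  where
  open ≤-Reasoning
  p u P : ℕ
  p = t + n
  u = 2 ^ e
  P = 2 ^ suc t
  below : sum (scaled M ∘ b) < (3 + p) * u
  below = tail-sum-< b inc (λ i → ≤-trans gap (head-least inc i)) b≤M
            (cong suc (trans (sym (+-suc p e)) M≡))
  split : ∀ p u → (3 + p) * u + suc p * u ≡ (2 + p) * (2 * u)
  split = solve-∀
  regroup : ∀ P u → P * (2 * u) ≡ 2 * P * u
  regroup = solve-∀

-- A single term v ≥ n + t + 2 contributes at most (n+t+2)/2^(n+t+2), which beats the tail estimate by one.
lone-gap-bound : ∀ {n M t e} (b : Fin 1 → ℕ) → b zero ≤ M → t + n + suc e ≡ M →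
                 2 + (t + n) ≤ b zero → Remainder n M t (suc e) b → SizeBound n (suc t)
lone-gap-bound {n} {M} {t} {e} b b₀≤M M≡ gap (remainder rem) =
  *-cancelˡ-≤ 2 (≤-trans (2[3+p]≤3[2+p] p) (*-cancelʳ-≤ _ _ u {{m^n≢0 2 e}}
    (+-cancelˡ-≤ ((2 + p) * u) _ _ (begin
      (2 + p) * u + 3 * (2 + p) * u   ≡⟨ quadruple p u ⟩
      2 * ((2 + p) * (2 * u))          ≡⟨ cong (2 *_) rem ⟨
      2 * (W + 0 + P * (2 * u))        ≡⟨ distribute W P u ⟩
      2 * W + 2 * (2 * P) * u          ≤⟨ +-monoˡ-≤ (2 * (2 * P) * u) twice-W ⟩
      (2 + p) * u + 2 * (2 * P) * u    ∎))))
  where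
  open ≤-Reasoning
  p u P v W : ℕ
  p = t + n
  u = 2 ^ e
  P = 2 ^ suc t
  v = b zero
  W = scaled M v
  depth : 2 + p + e ≡ v + suc (M ∸ v)
  depth = begin-equality
    2 + p + e           ≡⟨ cong suc (+-suc p e) ⟨
    suc (p + suc e)     ≡⟨ cong suc M≡ ⟩
    suc M               ≡⟨ cong suc (m+[n∸m]≡n b₀≤M) ⟨
    suc (v + (M ∸ v))   ≡⟨ +-suc v (M ∸ v) ⟨
    v + suc (M ∸ v)     ∎
  pull-two : ∀ v w → v * (2 * w) ≡ 2 * (v * w)
  pull-two = solve-∀
  twice-W : 2 * W ≤ (2 + p) * u
  twice-W = subst (_≤ (2 + p) * u) (pull-two v (2 ^ (M ∸ v)))
              (m/2^m-antitone (s≤s z≤n) gap depth)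
  quadruple : ∀ p u → (2 + p) * u + 3 * (2 + p) * u ≡ 2 * ((2 + p) * (2 * u))
  quadruple = solve-∀
  distribute : ∀ W P u → 2 * (W + 0 + P * (2 * u)) ≡ 2 * W + 2 * (2 * P) * u
  distribute = solve-∀
  2[3+p]≤3[2+p] : ∀ p → 2 * (3 + p) ≤ 3 * (2 + p)
  2[3+p]≤3[2+p] p = subst (2 * (3 + p) ≤_) (sym (expand p)) (m≤m+n _ p)
    where
    expand : ∀ p → 3 * (2 + p) ≡ 2 * (3 + p) + p
    expand = solve-∀

size-bound-beyond-gap : ∀ {n t} k → 2 + (t + n) ≤ 2 ^ suc (suc t) → SizeBound n (t + suc (suc k))
size-bound-beyond-gap {n} {t} k gap-bound = begin
  2 + (t + suc (suc k) + n)       ≤⟨ m≤m+n _ k ⟩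
  2 + (t + suc (suc k) + n) + k   ≡⟨ regroup t n k ⟩
  2 + (t + n) + 2 * suc k         ≤⟨ +-monoˡ-≤ (2 * suc k) gap-bound ⟩
  X + 2 * suc k                   ≤⟨ m+c*n≤m*2^n X (suc k) (*-monoʳ-≤ 2 (m^n>0 2 (suc t))) ⟩
  X * 2 ^ suc k                   ≡⟨ ^-distribˡ-+-* 2 (suc (suc t)) (suc k) ⟨
  2 ^ (suc (suc t) + suc k)       ≡⟨ cong (λ s → 2 ^ suc s) (+-suc t (suc k)) ⟨
  2 ^ suc (t + suc (suc k))       ∎
  where
  open ≤-Reasoning
  X : ℕ
  X = 2 ^ suc (suc t)
  regroup : ∀ t n k → 2 + (t + suc (suc k) + n) + k ≡ 2 + (t + n) + 2 * suc k
  regroup = solve-∀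

gap-forbids-long-run : ∀ {n t j} → 2 + (t + n) ≤ 2 ^ suc (suc t) → t < j → j + n < 2 ^ suc j
gap-forbids-long-run {n} {t} gap-bound t<j with m≤n⇒∃[o]m+o≡n t<j
... | r , refl = begin
  suc (suc t + r + n)             ≡⟨ regroup t r n ⟩
  2 + (t + n) + r                 ≤⟨ +-monoˡ-≤ r gap-bound ⟩
  2 ^ suc (suc t) + r             ≤⟨ m+n≤m*2^n _ r (m^n>0 2 (suc (suc t))) ⟩
  2 ^ suc (suc t) * 2 ^ r         ≡⟨ ^-distribˡ-+-* 2 (suc (suc t)) r ⟨
  2 ^ suc (suc t + r)             ∎
  where
  open ≤-Reasoning
  regroup : ∀ t r n → suc (suc t + r + n) ≡ 2 + (t + n) + r
  regroup = solve-∀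

record PeelOutcome (n t : ℕ) {k : ℕ} (b : Fin k → ℕ) : Set where
  constructor outcome
  field
    size-bound : SizeBound n (t + k)
    forced     : ∀ j → 2 ^ suc j ≤ j + n → ∀ i → t + toℕ i < j → b i ≡ suc (t + toℕ i + n)

PeelOutcome-cons : ∀ {n t k} (b : Fin (suc k) → ℕ) → b zero ≡ suc (t + n) →
                   PeelOutcome n (suc t) (b ∘ suc) → PeelOutcome n t b
PeelOutcome-cons {n} {t} {k} b b₀≡ (outcome size forced) =
  outcome (subst (SizeBound n) (sym (+-suc t k)) size) forced′
  where
  forced′ : ∀ j → 2 ^ suc j ≤ j + n → ∀ i → t + toℕ i < j → b i ≡ suc (t + toℕ i + n)
  forced′ j _    zero    _       = trans b₀≡ (cong (λ s → suc (s + n)) (sym (+-identityʳ t)))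
  forced′ j long (suc i) t+1+i<j =
    trans (forced j long i (subst (_< j) (+-suc t (toℕ i)) t+1+i<j))
          (cong (λ s → suc (s + n)) (sym (+-suc t (toℕ i))))

gap-size-bound : ∀ {n M t e k} (b : Fin (suc k) → ℕ) → Increasing b → (∀ i → b i ≤ M) →
                 t + n + suc e ≡ M → 2 + (t + n) ≤ b zero → Remainder n M t (suc e) b →
                 SizeBound n (t + suc k)
gap-size-bound {n} {t = t} {k = zero}  b _   b≤M M≡ gap rem =
  subst (SizeBound n) (sym (+-comm t 1)) (lone-gap-bound b (b≤M zero) M≡ gap rem)
gap-size-bound {n} {t = t} {k = suc k} b inc b≤M M≡ gap rem =
  size-bound-beyond-gap {n} {t} k (gap-bound b inc b≤M M≡ gap rem)

peel : ∀ {n M} k (b : Fin k → ℕ) t e → t + n + e ≡ M → Remainder n M t e b →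
       (∀ i → t + n < b i) → (∀ i → b i ≤ M) → Increasing b → PeelOutcome n t b
peel {n} zero b t e _ rem _ _ _ =
  outcome (subst (SizeBound n) (sym (+-identityʳ t)) (≤-reflexive (remainder-exhausted rem))) λ _ _ ()
peel (suc k) b t zero M≡ _ lo b≤M _ =
  ⊥-elim (<⇒≱ (lo zero) (≤-trans (b≤M zero) (≤-reflexive (trans (sym M≡) (+-identityʳ _)))))
peel {n} {M} (suc k) b t (suc e) M≡ rem lo b≤M inc with m≤n⇒m<n∨m≡n (lo zero)
... | inj₂ exact = PeelOutcome-cons b (sym exact)
  (peel k (b ∘ suc) (suc t) e M≡′ (remainder-step b M≡ (sym exact) rem) lo′ (b≤M ∘ suc) (Increasing-tail inc))
  where
  M≡′ : suc t + n + e ≡ M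
  M≡′ = trans (sym (+-suc (t + n) e)) M≡
  lo′ : ∀ i → suc t + n < b (suc i)
  lo′ i = subst (_< b (suc i)) (sym exact) (inc zero (suc i) (s≤s z≤n))
... | inj₁ gap = outcome (gap-size-bound b inc b≤M M≡ gap rem) no-long-run
  where
  no-long-run : ∀ j → 2 ^ suc j ≤ j + n → ∀ i → t + toℕ i < j → b i ≡ suc (t + toℕ i + n)
  no-long-run j long i t+i<j = ⊥-elim (<⇒≱ (gap-forbids-long-run bound t<j) long)
    where
    bound : 2 + (t + n) ≤ 2 ^ suc (suc t)
    bound = gap-bound b inc b≤M M≡ gap rem
    t<j : t < j
    t<j = ≤-<-trans (m≤m+n t (toℕ i)) t+i<j

SizeBound⇒≤ : ∀ {n s} → SizeBound n s → n ≤ 2 ^ (s + 1) ∸ s ∸ 2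
SizeBound⇒≤ {n} {s} bound =
  m+n≤o⇒m≤o∸n n (m+n≤o⇒m≤o∸n (n + 2) (subst₂ _≤_ (regroup s n) 2^[1+s]≡2^[s+1] bound))
  where
  regroup : ∀ s n → 2 + (s + n) ≡ n + 2 + s
  regroup = solve-∀
  2^[1+s]≡2^[s+1] : 2 ^ suc s ≡ 2 ^ (s + 1)
  2^[1+s]≡2^[s+1] = cong (2 ^_) (+-comm 1 s)

theorem2p1 : (k n : ℕ) (a : Fin k → ℕ) →
    (k≥2 : 2 ≤ k) → 1 ≤ n →
    (∀ i → 1 ≤ a i) →
    (∀ i j → toℕ i < toℕ j → a i < a j) →
    term n ≡ Σᶠ k (λ i → term (a i)) →
    (n ≤ (2 ^ (k + 1)) ∸ k ∸ 2)
    × (n + 1 ≤ a (first k≥2)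
       × a (first k≥2) ≤ n + 3
       × (2 ^ (a (last k≥2) ∸ a (penult k≥2)) ∣ a (last k≥2))
       × (∀ j → 1 ≤ j → j < k → (2 ^ (j + 1)) ∸ j ≤ n →
            ∀ (i : Fin k) → toℕ i < j → a i ≡ n + (toℕ i + 1)))
theorem2p1 (suc (suc k)) n a (s≤s (s≤s z≤n)) 1≤n 1≤a inc eq =
  SizeBound⇒≤ (PeelOutcome.size-bound peeled) ,
  subst (_≤ a zero) (+-comm 1 n) n<a₀ ,
  subst (a zero ≤_) (+-comm 3 n) (first-term-below a 1≤n inc a≤M cleared) ,
  last-gap-divides a inc n≤penult (cleared-equation a n≤last (last-greatest inc) eq) ,
  λ j _ _ long i i<j → trans (PeelOutcome.forced peeled j (long-run long) i i<j) (regroup (toℕ i) n)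
  where
  M : ℕ
  M = n + a (fromℕ (suc k))
  a≤M : ∀ i → a i ≤ M
  a≤M i = ≤-trans (last-greatest inc i) (m≤n+m _ n)
  cleared : scaled M n ≡ sum (scaled M ∘ a)
  cleared = cleared-equation a (m≤m+n n _) a≤M eq
  n<a₀ : n < a zero
  n<a₀ = first-term-above a 1≤a (m≤m+n n _) a≤M cleared
  n≤penult : n ≤ a (inject₁ (fromℕ k))
  n≤penult = <⇒≤ (<-≤-trans n<a₀ (last-greatest (Increasing-init inc) zero))
  n≤last : n ≤ a (fromℕ (suc k))
  n≤last = <⇒≤ (<-≤-trans n<a₀ (last-greatest inc zero))
  peeled : PeelOutcome n 0 a
  peeled = peel (suc (suc k)) a 0 (M ∸ n) (m+[n∸m]≡n (m≤m+n n _)) (remainder-start a cleared)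
             (λ i → <-≤-trans n<a₀ (head-least inc i)) a≤M inc
  long-run : ∀ {j} → 2 ^ (j + 1) ∸ j ≤ n → 2 ^ suc j ≤ j + n
  long-run {j} long = ≤-trans (≤-reflexive (cong (2 ^_) (+-comm 1 j)))
                        (≤-trans (m≤n+m∸n (2 ^ (j + 1)) j) (+-monoʳ-≤ j long))
  regroup : ∀ i n → suc (i + n) ≡ n + (i + 1)
  regroup = solve-∀
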